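{- Let $V$ be a finite set of size $v$, let $(\mathfrak{P}_0,\ldots,\mathfrak{P}_v)$ be a tactical sequence of partitions on $V$, and let $(V,\mathcal{D})$ be a non-empty $t$-$(v,k,\lambda)$ design with $t\leq k\leq v-t$ such that $\mathcal{D}=\bigcup\mathfrak{B}$ for some $\mathfrak{B}\subseteq\mathfrak{P}_k$. Let $x,y\in\{0,\ldots,k\}$ with $x\leq y$. Then \[W^{(xy)}\omega^{(y)}=\binom{k-x}{y-x}\omega^{(x)}.\]
   Context: $\binom{V}{x}$ is the set of $x$-subsets of $V$; each $\mathfrak{P}_x$ is a partition of $\binom{V}{x}$. $(\mathfrak{P}_0,\ldots,\mathfrak{P}_v)$ is a tactical sequence of partitions if for all $x\le y$ and all parts $\mathcal{X}\in\mathfrak{P}_x,\mathcal{Y}\in\mathfrak{P}_y$, the number $\#\{Y\in\mathcal{Y}\mid X\subseteq Y\}$ does not depend on $X\in\mathcal{X}$ and $\#\{X\in\mathcal{X}\mid X\subseteq Y\}$ does not depend on $Y\in\mathcal{Y}$; these values define $R^{(xy)}_{\mathcal{X},\mathcal{Y}}=\#\{Y\in\mathcal{Y}\mid X\subseteq Y\}$ (any $X\in\mathcal{X}$), a matrix in $\mathbb{Z}^{\mathfrak{P}_x\times\mathfrak{P}_y}$. A $t$-$(v,k,\lambda)$ design $(V,\mathcal{D})$ is a set $\mathcal{D}$ of $k$-subsets (blocks) of $V$ such that every $t$-subset lies in exactly $\lambda$ blocks. For $0\le x\le k$, $\rho^{(x)}\in\mathbb{Z}^{\mathfrak{P}_x\times\mathfrak{B}}$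 has entries $\rho^{(x)}_{\mathcal{X},\mathcal{B}}=\#\{B\in\mathcal{B}\mid X\subseteq B\}$ for any $X\in\mathcal{X}$. $D^{(x)}$ is the diagonal $\mathfrak{P}_x\times\mathfrak{P}_x$ matrix with entries $\#\mathcal{X}$, $\delta$ the diagonal $\mathfrak{B}\times\mathfrak{B}$ matrix with entries $\#\mathcal{B}$, and $\sqrt{\cdot}$ of such a matrix takes positive square roots of the diagonal entries. Define $W^{(xy)}=\sqrt{D^{(x)}}\,R^{(xy)}\,\sqrt{D^{(y)}}^{ -1}$ for $x\le y$ and $\omega^{(x)}=\sqrt{D^{(x)}}\,\rho^{(x)}\,\sqrt{\delta}^{ -1}$ for $0\le x\le k$. -}

module Defs where

open import Level using (Level)
open import Data.Nat using (ℕ; zero; suc; _≤_; _∸_)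
open import Data.Nat.Combinatorics using (_C_)
open import Data.Fin using (Fin)
open import Data.Fin.Subset using (Subset; ∣_∣; _⊆_; _∈_; inside; outside)
open import Data.Fin.Subset.Properties using (_⊆?_; _∈?_)
open import Data.Vec using (_∷_; [])
open import Data.List using (List; []; _∷_; map; _++_; filter; length)
open import Data.Product using (_×_; ∃; Σ-syntax)
open import Relation.Nullary.Decidable using (_×-dec_)
open import Relation.Binary.PropositionalEquality using (_≡_)
open import Algebra.Bundles using (CommutativeRing)
import Data.Nat as ℕ
import Data.Fin as F

allSubsets : (n : ℕ) → List (Subset n)
allSubsets zero    = [] ∷ []
allSubsets (suc n) = map (outside ∷_) (allSubsets n) ++ map (inside ∷_) (allSubsets n)

subsetsOfSize : (v x : ℕ) → List (Subset v)
subsetsOfSize v x = filter (λ S → ∣ S ∣ ℕ.≟ x) (allSubsets v)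

-- A sequence of partitions (P_0,...,P_v) of binom(V,0),...,binom(V,v).
-- P_x has np x parts, indexed by Fin (np x); lab x S is the part of P_x
-- containing the x-subset S (its value on subsets of other sizes is
-- irrelevant).  Parts of a partition are non-empty: rep x i is an element
-- of part i of P_x.

record PartitionSeq (v : ℕ) : Set where
  field
    np       : ℕ → ℕ
    lab      : (x : ℕ) → Subset v → Fin (np x)
    rep      : (x : ℕ) → Fin (np x) → Subset v
    rep-size : ∀ x → x ≤ v → ∀ i → ∣ rep x i ∣ ≡ x
    rep-lab  : ∀ x → x ≤ v → ∀ i → lab x (rep x i) ≡ i

module _ {v : ℕ} (P : PartitionSeq v) where
  open PartitionSeq P

  upCount : (y : ℕ) → Fin (np y) → Subset v → ℕ
  upCount y j X = length (filter (λ Y → (lab y Y F.≟ j) ×-dec (X ⊆? Y)) (subsetsOfSize v y))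

  downCount : (x : ℕ) → Fin (np x) → Subset v → ℕ
  downCount x i Y = length (filter (λ X → (lab x X F.≟ i) ×-dec (X ⊆? Y)) (subsetsOfSize v x))

  Tactical : Set
  Tactical = ∀ x y → x ≤ y → y ≤ v → (i : Fin (np x)) (j : Fin (np y)) →
    (∀ X X' → ∣ X ∣ ≡ x → lab x X ≡ i → ∣ X' ∣ ≡ x → lab x X' ≡ i →
       upCount y j X ≡ upCount y j X')
    × (∀ Y Y' → ∣ Y ∣ ≡ y → lab y Y ≡ j → ∣ Y' ∣ ≡ y → lab y Y' ≡ j →
       downCount x i Y ≡ downCount x i Y')

  -- #𝒳 for the part i of P_x  (diagonal entries of D^(x))
  partSize : (x : ℕ) → Fin (np x) → ℕ
  partSize x i = length (filter (λ S → lab x S F.≟ i) (subsetsOfSize v x))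

  -- R^(xy)_{i,j} = #{ Y ∈ 𝒴_j | X ⊆ Y } for any X ∈ 𝒳_i
  Rmat : (x y : ℕ) → Fin (np x) → Fin (np y) → ℕ
  Rmat x y i j = upCount y j (rep x i)

  -- The design D = ⋃ 𝔅 with 𝔅 ⊆ P_k given as a subset of the parts of P_k.
  -- (V, D) is a t-(v,k,λ) design:
  IsDesign : (t k lam : ℕ) → Subset (np k) → Set
  IsDesign t k lam 𝔅 = ∀ T → ∣ T ∣ ≡ t →
    length (filter (λ B → (lab k B ∈? 𝔅) ×-dec (T ⊆? B)) (subsetsOfSize v k)) ≡ lam

  DesignNonEmpty : (k : ℕ) → Subset (np k) → Set
  DesignNonEmpty k 𝔅 = ∃ λ B → ∣ B ∣ ≡ k × lab k B ∈ 𝔅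

  -- ρ^(x)_{i,b} = #{ B ∈ ℬ_b | X ⊆ B } for any X ∈ 𝒳_i  (b a part of P_k)
  rho : (k x : ℕ) → Fin (np x) → Fin (np k) → ℕ
  rho k x i b = upCount k b (rep x i)

-- The paper works over ℝ with positive square roots.  ℝ is not
-- available, so we work over an arbitrary commutative ring equipped with
-- square roots of the positive integers and their inverses (ℝ with the
-- positive square roots is an instance).

module _ {c ℓ : Level} (Rg : CommutativeRing c ℓ) where
  open CommutativeRing Rg

  ι : ℕ → Carrier
  ι zero    = 0#
  ι (suc n) = 1# + ι n

  sumFin : (n : ℕ) → (Fin n → Carrier) → Carrier
  sumFin zero    f = 0#
  sumFin (suc n) f = f F.zero + sumFin n (λ i → f (F.suc i))

  record SqrtData : Set (c Level.⊔ ℓ) where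
    field
      sqrt     : ℕ → Carrier
      sqrtInv  : ℕ → Carrier
      sqrt-sq  : ∀ n → sqrt n * sqrt n ≈ ι n
      sqrt-inv : ∀ n → 1 ≤ n → sqrt n * sqrtInv n ≈ 1#
      inv-sqrt : ∀ n → 1 ≤ n → sqrtInv n * sqrt n ≈ 1#

  module _ (S : SqrtData) {v : ℕ} (P : PartitionSeq v) where
    open SqrtData S
    open PartitionSeq P

    -- W^(xy) = √D^(x) R^(xy) √D^(y)^{-1}
    Wmat : (x y : ℕ) → Fin (np x) → Fin (np y) → Carrier
    Wmat x y i j = sqrt (partSize P x i) * ι (Rmat P x y i j) * sqrtInv (partSize P y j)

    -- ω^(x) = √D^(x) ρ^(x) √δ^{-1}   (columns indexed by parts b of P_k, b ∈ 𝔅)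
    omega : (k x : ℕ) → Fin (np x) → Fin (np k) → Carrier
    omega k x i b = sqrt (partSize P x i) * ι (rho P k x i b) * sqrtInv (partSize P k b)

    Womega : (k x y : ℕ) → Fin (np x) → Fin (np k) → Carrier
    Womega k x y i b = sumFin (np y) (λ j → Wmat x y i j * omega k y j b)

{-# OPTIONS --safe #-}
module Submission where

-- The diagonal factors √D^(y) and √D^(y)⁻¹ cancel in the product, so
-- W^(xy) ω^(y) = √D^(x) (R^(xy) ρ^(y)) √δ⁻¹ and it suffices to prove the integer identity
-- R^(xy) ρ^(y) = C(k−x, y−x) ρ^(x).  By tacticality, the (X, ℬ)-entry of the left side
-- counts the pairs (Y, B) with X ⊆ Y ⊆ B, |Y| = y and B ∈ ℬ; grouping them by B, each
-- B ⊇ X contributes the C(k−x, y−x) sets of size y lying between X and B.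

open import Defs
open import Level using (Level)
open import Data.Nat using (ℕ; zero; suc; _+_; _*_; _≤_; _∸_)
import Data.Nat as ℕ
open import Data.Nat.Properties
open import Data.Nat.Tactic.RingSolver using (solve-∀)
open import Data.Nat.Combinatorics using (_C_; nCk+nC[k+1]≡[n+1]C[k+1])
open import Data.Nat.ListAction using () renaming (sum to sumˡ)
open import Data.Nat.ListAction.Properties using (sum-++)
open import Data.Bool using (if_then_else_)
open import Data.Fin using (Fin)
import Data.Fin as F
open import Data.Fin.Subset using (Subset; ∣_∣; _⊆_; _∈_; inside; outside)
open import Data.Fin.Subset.Properties using (_⊆?_; p⊆q⇒∣p∣≤∣q∣; ⊆-trans; drop-∷-⊆)
open import Data.Vec using (_∷_; []; here)
open import Data.List using ([]; _∷_; map; _++_; filter; length)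
open import Data.List.Properties using (map-++; map-∘)
open import Data.Product using (proj₁)
open import Data.Empty using (⊥-elim)
open import Function using (_∘_)
open import Relation.Nullary using (Dec; yes; no; ¬_; does)
open import Relation.Nullary.Decidable using (_×-dec_)
open import Relation.Unary using (Pred; Decidable)
open import Relation.Binary.PropositionalEquality
open import Algebra.Bundles using (CommutativeRing)
open import Algebra.Properties.CommutativeSemigroup +-commutativeSemigroup using (interchange)
open import Algebra.Properties.CommutativeSemigroup *-commutativeSemigroup using (x∙yz≈y∙xz)
open import Algebra.Properties.Semiring.Sum +-*-semiring
  using (sum-syntax; sum-cong-≗; sum-replicate-zero)

𝟙 : ∀ {p} {P : Set p} → Dec P → ℕ
𝟙 d = if does d then 1 else 0

𝟙-yes : ∀ {p} {P : Set p} → P → (d : Dec P) → 𝟙 d ≡ 1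
𝟙-yes p (yes _) = refl
𝟙-yes p (no ¬p) = ⊥-elim (¬p p)

𝟙-× : ∀ {p q} {P : Set p} {Q : Set q} (d : Dec P) (e : Dec Q) → 𝟙 (d ×-dec e) ≡ 𝟙 d * 𝟙 e
𝟙-× (yes _) (yes _) = refl
𝟙-× (yes _) (no _)  = refl
𝟙-× (no _)  _       = refl

𝟙-disjoint : ∀ {p q} {P : Set p} {Q : Set q} → (P → ¬ Q) → (d : Dec P) (e : Dec Q) → 𝟙 d * 𝟙 e ≡ 0
𝟙-disjoint ¬PQ (yes p) (yes q) = ⊥-elim (¬PQ p q)
𝟙-disjoint ¬PQ (yes _) (no _)  = refl
𝟙-disjoint ¬PQ (no _)  _       = refl

𝟙-guard : ∀ {p} {P : Set p} {m n} a → (P → m ≡ n) → (d : Dec P) → 𝟙 d * a * m ≡ 𝟙 d * a * n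
𝟙-guard a m≡n (yes p) = cong (1 * a *_) (m≡n p)
𝟙-guard a m≡n (no _)  = refl

∑-sift : ∀ {n} (l : Fin n) (f : Fin n → ℕ) → ∑[ j < n ] (𝟙 (l F.≟ j) * f j) ≡ f l
∑-sift {suc n} F.zero f =
  trans (cong₂ _+_ (+-identityʳ (f F.zero)) (sum-replicate-zero n)) (+-identityʳ (f F.zero))
∑-sift {suc n} (F.suc l) f = ∑-sift l (f ∘ F.suc)

∑ˢ : (n : ℕ) → (Subset n → ℕ) → ℕ
∑ˢ zero    f = f []
∑ˢ (suc n) f = ∑ˢ n (f ∘ (outside ∷_)) + ∑ˢ n (f ∘ (inside ∷_))

∑ˢ-cong : ∀ n {f g : Subset n → ℕ} → (∀ S → f S ≡ g S) → ∑ˢ n f ≡ ∑ˢ n g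
∑ˢ-cong zero    f≗g = f≗g []
∑ˢ-cong (suc n) f≗g = cong₂ _+_ (∑ˢ-cong n (f≗g ∘ (outside ∷_))) (∑ˢ-cong n (f≗g ∘ (inside ∷_)))

∑ˢ-zero : ∀ n {f : Subset n → ℕ} → (∀ S → f S ≡ 0) → ∑ˢ n f ≡ 0
∑ˢ-zero zero    f≗0 = f≗0 []
∑ˢ-zero (suc n) f≗0 = cong₂ _+_ (∑ˢ-zero n (f≗0 ∘ (outside ∷_))) (∑ˢ-zero n (f≗0 ∘ (inside ∷_)))

∑ˢ-+ : ∀ n (f g : Subset n → ℕ) → ∑ˢ n (λ S → f S + g S) ≡ ∑ˢ n f + ∑ˢ n g
∑ˢ-+ zero    f g = refl
∑ˢ-+ (suc n) f g = trans
  (cong₂ _+_ (∑ˢ-+ n (f ∘ (outside ∷_)) (g ∘ (outside ∷_))) (∑ˢ-+ n (f ∘ (inside ∷_)) (g ∘ (inside ∷_))))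
  (interchange (∑ˢ n (f ∘ (outside ∷_))) (∑ˢ n (g ∘ (outside ∷_)))
               (∑ˢ n (f ∘ (inside ∷_))) (∑ˢ n (g ∘ (inside ∷_))))

∑ˢ-*ˡ : ∀ n c (f : Subset n → ℕ) → ∑ˢ n (λ S → c * f S) ≡ c * ∑ˢ n f
∑ˢ-*ˡ zero    c f = refl
∑ˢ-*ˡ (suc n) c f = trans
  (cong₂ _+_ (∑ˢ-*ˡ n c (f ∘ (outside ∷_))) (∑ˢ-*ˡ n c (f ∘ (inside ∷_))))
  (sym (*-distribˡ-+ c _ _))

∑ˢ-*ʳ : ∀ n c (f : Subset n → ℕ) → ∑ˢ n (λ S → f S * c) ≡ ∑ˢ n f * c
∑ˢ-*ʳ n c f = trans (∑ˢ-cong n (λ S → *-comm (f S) c)) (trans (∑ˢ-*ˡ n c f) (*-comm c (∑ˢ n f)))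

∑ˢ-comm : ∀ n m (f : Subset n → Subset m → ℕ) →
  ∑ˢ n (λ A → ∑ˢ m (f A)) ≡ ∑ˢ m (λ B → ∑ˢ n (λ A → f A B))
∑ˢ-comm zero    m f = refl
∑ˢ-comm (suc n) m f = trans
  (cong₂ _+_ (∑ˢ-comm n m (f ∘ (outside ∷_))) (∑ˢ-comm n m (f ∘ (inside ∷_))))
  (sym (∑ˢ-+ m _ _))

∑-∑ˢ-comm : ∀ m n (f : Fin m → Subset n → ℕ) →
  ∑[ j < m ] ∑ˢ n (f j) ≡ ∑ˢ n (λ S → ∑[ j < m ] f j S)
∑-∑ˢ-comm zero    n f = sym (∑ˢ-zero n (λ _ → refl))
∑-∑ˢ-comm (suc m) n f = trans
  (cong (∑ˢ n (f F.zero) +_) (∑-∑ˢ-comm m n (f ∘ F.suc)))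
  (sym (∑ˢ-+ n (f F.zero) _))

≤-∑ˢ : ∀ {n} (f : Subset n → ℕ) S → f S ≤ ∑ˢ n f
≤-∑ˢ f []            = ≤-refl
≤-∑ˢ f (outside ∷ S) = ≤-trans (≤-∑ˢ (f ∘ (outside ∷_)) S) (m≤m+n _ _)
≤-∑ˢ f (inside ∷ S)  = ≤-trans (≤-∑ˢ (f ∘ (inside ∷_)) S) (m≤n+m _ _)

sum-map-allSubsets : ∀ n (f : Subset n → ℕ) → sumˡ (map f (allSubsets n)) ≡ ∑ˢ n f
sum-map-allSubsets zero    f = +-identityʳ (f [])
sum-map-allSubsets (suc n) f = begin
  sumˡ (map f (outsides ++ insides))
    ≡⟨ cong sumˡ (map-++ f outsides insides) ⟩
  sumˡ (map f outsides ++ map f insides)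
    ≡⟨ sum-++ (map f outsides) (map f insides) ⟩
  sumˡ (map f outsides) + sumˡ (map f insides)
    ≡⟨ cong₂ _+_ (cong sumˡ (sym (map-∘ (allSubsets n)))) (cong sumˡ (sym (map-∘ (allSubsets n)))) ⟩
  sumˡ (map (f ∘ (outside ∷_)) (allSubsets n)) + sumˡ (map (f ∘ (inside ∷_)) (allSubsets n))
    ≡⟨ cong₂ _+_ (sum-map-allSubsets n _) (sum-map-allSubsets n _) ⟩
  ∑ˢ (suc n) f ∎
  where
  open ≡-Reasoning
  outsides = map (outside ∷_) (allSubsets n)
  insides  = map (inside ∷_) (allSubsets n)

length-filter : ∀ {a p} {A : Set a} {P : Pred A p} (P? : Decidable P) xs →
  length (filter P? xs) ≡ sumˡ (map (𝟙 ∘ P?) xs)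
length-filter P? []       = refl
length-filter P? (x ∷ xs) with P? x
... | yes _ = cong suc (length-filter P? xs)
... | no _  = length-filter P? xs

sum-map-filter : ∀ {a p} {A : Set a} {P : Pred A p} (P? : Decidable P) (f : A → ℕ) xs →
  sumˡ (map f (filter P? xs)) ≡ sumˡ (map (λ x → 𝟙 (P? x) * f x) xs)
sum-map-filter P? f []       = refl
sum-map-filter P? f (x ∷ xs) with P? x
... | yes _ = cong₂ _+_ (sym (+-identityʳ (f x))) (sum-map-filter P? f xs)
... | no _  = sum-map-filter P? f xs

module _ {v : ℕ} {p} {P : Pred (Subset v) p} (P? : Decidable P) where

  count≡∑ˢ : ∀ x → length (filter P? (subsetsOfSize v x)) ≡ ∑ˢ v (λ S → 𝟙 (∣ S ∣ ℕ.≟ x) * 𝟙 (P? S))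
  count≡∑ˢ x = begin
    length (filter P? (subsetsOfSize v x))
      ≡⟨ length-filter P? (subsetsOfSize v x) ⟩
    sumˡ (map (𝟙 ∘ P?) (subsetsOfSize v x))
      ≡⟨ sum-map-filter (λ S → ∣ S ∣ ℕ.≟ x) (𝟙 ∘ P?) (allSubsets v) ⟩
    sumˡ (map (λ S → 𝟙 (∣ S ∣ ℕ.≟ x) * 𝟙 (P? S)) (allSubsets v))
      ≡⟨ sum-map-allSubsets v _ ⟩
    ∑ˢ v (λ S → 𝟙 (∣ S ∣ ℕ.≟ x) * 𝟙 (P? S)) ∎
    where open ≡-Reasoning

  count-pos : ∀ {x} S → ∣ S ∣ ≡ x → P S → 1 ≤ length (filter P? (subsetsOfSize v x))
  count-pos {x} S ∣S∣≡x PS = begin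
    1                                        ≡⟨ sym (cong₂ _*_ (𝟙-yes ∣S∣≡x (∣ S ∣ ℕ.≟ x)) (𝟙-yes PS (P? S))) ⟩
    𝟙 (∣ S ∣ ℕ.≟ x) * 𝟙 (P? S)               ≤⟨ ≤-∑ˢ (λ S → 𝟙 (∣ S ∣ ℕ.≟ x) * 𝟙 (P? S)) S ⟩
    ∑ˢ v (λ S → 𝟙 (∣ S ∣ ℕ.≟ x) * 𝟙 (P? S))  ≡⟨ sym (count≡∑ˢ x) ⟩
    length (filter P? (subsetsOfSize v x))   ∎
    where open ≤-Reasoning

interval-count : ∀ {n} (X B : Subset n) → X ⊆ B → ∀ m d → ∣ B ∣ ≡ ∣ X ∣ + m →
  ∑ˢ n (λ Y → 𝟙 (∣ Y ∣ ℕ.≟ ∣ X ∣ + d) * 𝟙 (X ⊆? Y) * 𝟙 (Y ⊆? B)) ≡ m C d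
interval-count [] [] _ .0 zero    refl = refl
interval-count [] [] _ .0 (suc d) refl = refl
interval-count {suc n} (outside ∷ X) (outside ∷ B) X⊆B m d ∣B∣≡ = trans
  (cong₂ _+_ (interval-count X B (drop-∷-⊆ X⊆B) m d ∣B∣≡)
             (∑ˢ-zero n (λ Y → *-zeroʳ (𝟙 (suc ∣ Y ∣ ℕ.≟ ∣ X ∣ + d) * 𝟙 (X ⊆? Y)))))
  (+-identityʳ (m C d))
interval-count (outside ∷ X) (inside ∷ B) X⊆B zero d ∣B∣≡ =
  ⊥-elim (1+n≰n (≤-trans (≤-reflexive (trans ∣B∣≡ (+-identityʳ _))) (p⊆q⇒∣p∣≤∣q∣ (drop-∷-⊆ X⊆B))))
interval-count {suc n} (outside ∷ X) (inside ∷ B) X⊆B (suc m) zero ∣B∣≡ =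
  cong₂ _+_ (interval-count X B X⊆B′ m zero ∣B′∣≡) (∑ˢ-zero n Y∌X)
  where
  X⊆B′ = drop-∷-⊆ X⊆B
  ∣B′∣≡ = suc-injective (trans ∣B∣≡ (+-suc _ m))
  Y∌X : ∀ Y → 𝟙 (suc ∣ Y ∣ ℕ.≟ ∣ X ∣ + 0) * 𝟙 (X ⊆? Y) * 𝟙 (Y ⊆? B) ≡ 0
  Y∌X Y = cong (_* 𝟙 (Y ⊆? B)) (𝟙-disjoint
    (λ ∣Y∣≡ (X⊆Y : X ⊆ Y) → 1+n≰n (≤-trans (≤-reflexive (trans ∣Y∣≡ (+-identityʳ _))) (p⊆q⇒∣p∣≤∣q∣ X⊆Y)))
    (suc ∣ Y ∣ ℕ.≟ ∣ X ∣ + 0) (X ⊆? Y))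
interval-count {suc n} (outside ∷ X) (inside ∷ B) X⊆B (suc m) (suc d) ∣B∣≡ = trans
  (cong₂ _+_ (interval-count X B X⊆B′ m (suc d) ∣B′∣≡)
             (trans (∑ˢ-cong n (λ Y → cong (λ s → 𝟙 (suc ∣ Y ∣ ℕ.≟ s) * 𝟙 (X ⊆? Y) * 𝟙 (Y ⊆? B))
                                             (+-suc ∣ X ∣ d)))
                    (interval-count X B X⊆B′ m d ∣B′∣≡)))
  (trans (+-comm (m C suc d) (m C d)) (nCk+nC[k+1]≡[n+1]C[k+1] m d))
  where
  X⊆B′ = drop-∷-⊆ X⊆B
  ∣B′∣≡ = suc-injective (trans ∣B∣≡ (+-suc _ m))
interval-count (inside ∷ X) (outside ∷ B) X⊆B m d ∣B∣≡ with () ← X⊆B here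
interval-count {suc n} (inside ∷ X) (inside ∷ B) X⊆B m d ∣B∣≡ = cong₂ _+_
  (∑ˢ-zero n (λ Y → cong (_* 𝟙 (Y ⊆? B)) (*-zeroʳ (𝟙 (∣ Y ∣ ℕ.≟ suc (∣ X ∣ + d))))))
  (interval-count X B (drop-∷-⊆ X⊆B) m d (suc-injective ∣B∣≡))

subsets-between : ∀ {n} (X B : Subset n) {y} → ∣ X ∣ ≤ y →
  ∑ˢ n (λ Y → 𝟙 (∣ Y ∣ ℕ.≟ y) * 𝟙 (X ⊆? Y) * 𝟙 (Y ⊆? B)) ≡ ((∣ B ∣ ∸ ∣ X ∣) C (y ∸ ∣ X ∣)) * 𝟙 (X ⊆? B)
subsets-between {n} X B {y} ∣X∣≤y with X ⊆? B
... | yes X⊆B = trans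
  (subst (λ s → ∑ˢ n (λ Y → 𝟙 (∣ Y ∣ ℕ.≟ s) * 𝟙 (X ⊆? Y) * 𝟙 (Y ⊆? B)) ≡ (∣ B ∣ ∸ ∣ X ∣) C (y ∸ ∣ X ∣))
         (m+[n∸m]≡n ∣X∣≤y)
         (interval-count X B X⊆B (∣ B ∣ ∸ ∣ X ∣) (y ∸ ∣ X ∣) (sym (m+[n∸m]≡n (p⊆q⇒∣p∣≤∣q∣ X⊆B)))))
  (sym (*-identityʳ ((∣ B ∣ ∸ ∣ X ∣) C (y ∸ ∣ X ∣))))
... | no X⊈B = trans
  (∑ˢ-zero n (λ Y → trans (*-assoc (𝟙 (∣ Y ∣ ℕ.≟ y)) _ _)
    (trans (cong (𝟙 (∣ Y ∣ ℕ.≟ y) *_)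
                 (𝟙-disjoint (λ (X⊆Y : X ⊆ Y) (Y⊆B : Y ⊆ B) → X⊈B (⊆-trans X⊆Y Y⊆B)) (X ⊆? Y) (Y ⊆? B)))
           (*-zeroʳ (𝟙 (∣ Y ∣ ℕ.≟ y))))))
  (sym (*-zeroʳ ((∣ B ∣ ∸ ∣ X ∣) C (y ∸ ∣ X ∣))))

double-count : ∀ {n} (X : Subset n) (q : Subset n → ℕ) {y k} → ∣ X ∣ ≤ y →
  ∑ˢ n (λ Y → 𝟙 (∣ Y ∣ ℕ.≟ y) * 𝟙 (X ⊆? Y) * ∑ˢ n (λ B → 𝟙 (∣ B ∣ ℕ.≟ k) * q B * 𝟙 (Y ⊆? B)))
    ≡ ((k ∸ ∣ X ∣) C (y ∸ ∣ X ∣)) * ∑ˢ n (λ B → 𝟙 (∣ B ∣ ℕ.≟ k) * q B * 𝟙 (X ⊆? B))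
double-count {n} X q {y} {k} ∣X∣≤y = begin
  ∑ˢ n (λ Y → a Y * ∑ˢ n (λ B → w B * 𝟙 (Y ⊆? B)))
    ≡⟨ ∑ˢ-cong n (λ Y → sym (∑ˢ-*ˡ n (a Y) _)) ⟩
  ∑ˢ n (λ Y → ∑ˢ n (λ B → a Y * (w B * 𝟙 (Y ⊆? B))))
    ≡⟨ ∑ˢ-comm n n _ ⟩
  ∑ˢ n (λ B → ∑ˢ n (λ Y → a Y * (w B * 𝟙 (Y ⊆? B))))
    ≡⟨ ∑ˢ-cong n (λ B → trans (∑ˢ-cong n (λ Y → x∙yz≈y∙xz (a Y) (w B) _)) (∑ˢ-*ˡ n (w B) _)) ⟩
  ∑ˢ n (λ B → w B * ∑ˢ n (λ Y → a Y * 𝟙 (Y ⊆? B)))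
    ≡⟨ ∑ˢ-cong n (λ B → 𝟙-guard (q B) (λ ∣B∣≡k → trans (subsets-between X B ∣X∣≤y)
                                        (cong (λ s → ((s ∸ ∣ X ∣) C (y ∸ ∣ X ∣)) * 𝟙 (X ⊆? B)) ∣B∣≡k))
                                  (∣ B ∣ ℕ.≟ k)) ⟩
  ∑ˢ n (λ B → w B * (c * 𝟙 (X ⊆? B)))
    ≡⟨ ∑ˢ-cong n (λ B → x∙yz≈y∙xz (w B) c _) ⟩
  ∑ˢ n (λ B → c * (w B * 𝟙 (X ⊆? B)))
    ≡⟨ ∑ˢ-*ˡ n c _ ⟩
  c * ∑ˢ n (λ B → w B * 𝟙 (X ⊆? B)) ∎
  where
  open ≡-Reasoning
  a w : Subset n → ℕ
  a Y = 𝟙 (∣ Y ∣ ℕ.≟ y) * 𝟙 (X ⊆? Y)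
  w B = 𝟙 (∣ B ∣ ℕ.≟ k) * q B
  c = (k ∸ ∣ X ∣) C (y ∸ ∣ X ∣)

module _ {v : ℕ} (P : PartitionSeq v) where
  open PartitionSeq P

  upCount≡∑ˢ : ∀ y j X →
    upCount P y j X ≡ ∑ˢ v (λ Y → 𝟙 (∣ Y ∣ ℕ.≟ y) * 𝟙 (lab y Y F.≟ j) * 𝟙 (X ⊆? Y))
  upCount≡∑ˢ y j X = trans (count≡∑ˢ (λ Y → (lab y Y F.≟ j) ×-dec (X ⊆? Y)) y) (∑ˢ-cong v λ Y →
    trans (cong (𝟙 (∣ Y ∣ ℕ.≟ y) *_) (𝟙-× (lab y Y F.≟ j) (X ⊆? Y)))
          (sym (*-assoc (𝟙 (∣ Y ∣ ℕ.≟ y)) (𝟙 (lab y Y F.≟ j)) (𝟙 (X ⊆? Y)))))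

  partSize-pos : ∀ y → y ≤ v → ∀ j → 1 ≤ partSize P y j
  partSize-pos y y≤v j = count-pos (λ S → lab y S F.≟ j) (rep y j) (rep-size y y≤v j) (rep-lab y y≤v j)

  ∑-upCount-* : ∀ y X (h : Fin (np y) → ℕ) →
    ∑[ j < np y ] (upCount P y j X * h j) ≡ ∑ˢ v (λ Y → 𝟙 (∣ Y ∣ ℕ.≟ y) * 𝟙 (X ⊆? Y) * h (lab y Y))
  ∑-upCount-* y X h = begin
    ∑[ j < np y ] (upCount P y j X * h j)
      ≡⟨ sum-cong-≗ (λ j → trans (cong (_* h j) (upCount≡∑ˢ y j X)) (sym (∑ˢ-*ʳ v (h j) _))) ⟩
    ∑[ j < np y ] ∑ˢ v (λ Y → s Y * L j Y * t Y * h j)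
      ≡⟨ ∑-∑ˢ-comm (np y) v _ ⟩
    ∑ˢ v (λ Y → ∑[ j < np y ] (s Y * L j Y * t Y * h j))
      ≡⟨ ∑ˢ-cong v (λ Y → trans (sum-cong-≗ (λ j → move-label (s Y) (L j Y) (t Y) (h j)))
                                 (∑-sift (lab y Y) (λ j → s Y * t Y * h j))) ⟩
    ∑ˢ v (λ Y → s Y * t Y * h (lab y Y)) ∎
    where
    open ≡-Reasoning
    s t : Subset v → ℕ
    s Y = 𝟙 (∣ Y ∣ ℕ.≟ y)
    t Y = 𝟙 (X ⊆? Y)
    L : Fin (np y) → Subset v → ℕ
    L j Y = 𝟙 (lab y Y F.≟ j)
    move-label : ∀ a l b c → a * l * b * c ≡ l * (a * b * c)
    move-label = solve-∀

  module _ (T : Tactical P) where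

    upCount-rep-lab : ∀ {y k} → y ≤ k → k ≤ v → ∀ b Y → ∣ Y ∣ ≡ y →
      upCount P k b (rep y (lab y Y)) ≡ upCount P k b Y
    upCount-rep-lab {y} {k} y≤k k≤v b Y ∣Y∣≡y =
      proj₁ (T y k y≤k k≤v (lab y Y) b) (rep y (lab y Y)) Y
        (rep-size y y≤v (lab y Y)) (rep-lab y y≤v (lab y Y)) ∣Y∣≡y refl
      where y≤v = ≤-trans y≤k k≤v

    ∑-Rmat-rho : ∀ {k x y} → x ≤ y → y ≤ k → k ≤ v → ∀ i b →
      ∑[ j < np y ] (Rmat P x y i j * rho P k y j b) ≡ ((k ∸ x) C (y ∸ x)) * rho P k x i b
    ∑-Rmat-rho {k} {x} {y} x≤y y≤k k≤v i b = begin
      ∑[ j < np y ] (upCount P y j X * upCount P k b (rep y j))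
        ≡⟨ ∑-upCount-* y X (λ j → upCount P k b (rep y j)) ⟩
      ∑ˢ v (λ Y → s Y * t Y * upCount P k b (rep y (lab y Y)))
        ≡⟨ ∑ˢ-cong v (λ Y → 𝟙-guard (t Y) (upCount-rep-lab y≤k k≤v b Y) (∣ Y ∣ ℕ.≟ y)) ⟩
      ∑ˢ v (λ Y → s Y * t Y * upCount P k b Y)
        ≡⟨ ∑ˢ-cong v (λ Y → cong (s Y * t Y *_) (upCount≡∑ˢ k b Y)) ⟩
      ∑ˢ v (λ Y → s Y * t Y * ∑ˢ v (λ B → 𝟙 (∣ B ∣ ℕ.≟ k) * 𝟙 (lab k B F.≟ b) * 𝟙 (Y ⊆? B)))
        ≡⟨ double-count X (λ B → 𝟙 (lab k B F.≟ b)) (subst (_≤ y) (sym ∣X∣≡x) x≤y) ⟩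
      ((k ∸ ∣ X ∣) C (y ∸ ∣ X ∣)) * ∑ˢ v (λ B → 𝟙 (∣ B ∣ ℕ.≟ k) * 𝟙 (lab k B F.≟ b) * 𝟙 (X ⊆? B))
        ≡⟨ cong₂ (λ z u → ((k ∸ z) C (y ∸ z)) * u) ∣X∣≡x (sym (upCount≡∑ˢ k b X)) ⟩
      ((k ∸ x) C (y ∸ x)) * upCount P k b X ∎
      where
      open ≡-Reasoning
      X = rep x i
      ∣X∣≡x : ∣ X ∣ ≡ x
      ∣X∣≡x = rep-size x (≤-trans x≤y (≤-trans y≤k k≤v)) i
      s t : Subset v → ℕ
      s Y = 𝟙 (∣ Y ∣ ℕ.≟ y)
      t Y = 𝟙 (X ⊆? Y)

module _ {c ℓ : Level} (Rg : CommutativeRing c ℓ) where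
  private module R = CommutativeRing Rg
  open R using (Carrier; _≈_; 1#) renaming (_+_ to _⊕_; _*_ to _⊗_)
  open import Relation.Binary.Reasoning.Setoid R.setoid
  open import Algebra.Solver.CommutativeMonoid R.*-commutativeMonoid using (solve; _⊜_)
    renaming (_⊕_ to _·_)

  ι-homo-+ : ∀ m n → ι Rg (m + n) ≈ ι Rg m ⊕ ι Rg n
  ι-homo-+ zero    n = R.sym (R.+-identityˡ (ι Rg n))
  ι-homo-+ (suc m) n = R.trans (R.+-congˡ (ι-homo-+ m n)) (R.sym (R.+-assoc 1# (ι Rg m) (ι Rg n)))

  ι-homo-* : ∀ m n → ι Rg (m * n) ≈ ι Rg m ⊗ ι Rg n
  ι-homo-* zero    n = R.sym (R.zeroˡ (ι Rg n))
  ι-homo-* (suc m) n = begin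
    ι Rg (n + m * n)                 ≈⟨ ι-homo-+ n (m * n) ⟩
    ι Rg n ⊕ ι Rg (m * n)            ≈⟨ R.+-cong (R.sym (R.*-identityˡ (ι Rg n))) (ι-homo-* m n) ⟩
    1# ⊗ ι Rg n ⊕ ι Rg m ⊗ ι Rg n    ≈⟨ R.sym (R.distribʳ (ι Rg n) 1# (ι Rg m)) ⟩
    (1# ⊕ ι Rg m) ⊗ ι Rg n           ∎

  sumFin-cong : ∀ n {f g : Fin n → Carrier} → (∀ j → f j ≈ g j) → sumFin Rg n f ≈ sumFin Rg n g
  sumFin-cong zero    f≈g = R.refl
  sumFin-cong (suc n) f≈g = R.+-cong (f≈g F.zero) (sumFin-cong n (f≈g ∘ F.suc))

  sumFin-*ι : ∀ n a (f : Fin n → ℕ) → sumFin Rg n (λ j → a ⊗ ι Rg (f j)) ≈ a ⊗ ι Rg (∑[ j < n ] f j)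
  sumFin-*ι zero    a f = R.sym (R.zeroʳ a)
  sumFin-*ι (suc n) a f = begin
    a ⊗ ι Rg (f F.zero) ⊕ sumFin Rg n (λ j → a ⊗ ι Rg (f (F.suc j)))
      ≈⟨ R.+-congˡ (sumFin-*ι n a (f ∘ F.suc)) ⟩
    a ⊗ ι Rg (f F.zero) ⊕ a ⊗ ι Rg (∑[ j < n ] f (F.suc j))
      ≈⟨ R.sym (R.distribˡ a _ _) ⟩
    a ⊗ (ι Rg (f F.zero) ⊕ ι Rg (∑[ j < n ] f (F.suc j)))
      ≈⟨ R.*-congˡ (R.sym (ι-homo-+ (f F.zero) _)) ⟩
    a ⊗ ι Rg (∑[ j < suc n ] f j) ∎

  sumFin-conjugate : ∀ n a e (s t : Fin n → Carrier) (r p : Fin n → ℕ) → (∀ j → t j ⊗ s j ≈ 1#) →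
    sumFin Rg n (λ j → (a ⊗ ι Rg (r j) ⊗ t j) ⊗ (s j ⊗ ι Rg (p j) ⊗ e))
      ≈ (a ⊗ e) ⊗ ι Rg (∑[ j < n ] (r j * p j))
  sumFin-conjugate n a e s t r p ts≈1 =
    R.trans (sumFin-cong n term) (sumFin-*ι n (a ⊗ e) (λ j → r j * p j))
    where
    term : ∀ j → (a ⊗ ι Rg (r j) ⊗ t j) ⊗ (s j ⊗ ι Rg (p j) ⊗ e) ≈ (a ⊗ e) ⊗ ι Rg (r j * p j)
    term j = begin
      (a ⊗ ι Rg (r j) ⊗ t j) ⊗ (s j ⊗ ι Rg (p j) ⊗ e)
        ≈⟨ solve 6 (λ a r t s p e → ((a · r) · t) · ((s · p) · e) ⊜ (t · s) · ((a · e) · (r · p))) R.refl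
                 a (ι Rg (r j)) (t j) (s j) (ι Rg (p j)) e ⟩
      (t j ⊗ s j) ⊗ ((a ⊗ e) ⊗ (ι Rg (r j) ⊗ ι Rg (p j)))
        ≈⟨ R.trans (R.*-congʳ (ts≈1 j)) (R.*-identityˡ _) ⟩
      (a ⊗ e) ⊗ (ι Rg (r j) ⊗ ι Rg (p j))
        ≈⟨ R.*-congˡ (R.sym (ι-homo-* (r j) (p j))) ⟩
      (a ⊗ e) ⊗ ι Rg (r j * p j) ∎

  ι-*-factor : ∀ a e m u → (a ⊗ e) ⊗ ι Rg (m * u) ≈ ι Rg m ⊗ (a ⊗ ι Rg u ⊗ e)
  ι-*-factor a e m u = R.trans (R.*-congˡ (ι-homo-* m u))
    (solve 4 (λ a e m u → (a · e) · (m · u) ⊜ m · ((a · u) · e)) R.refl a e (ι Rg m) (ι Rg u))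

lemma3p16 : ∀ {c ℓ : Level} (Rg : CommutativeRing c ℓ) (S : SqrtData Rg)
    (v : ℕ) (P : PartitionSeq v) → Tactical P →
    (t k lam : ℕ) (𝔅 : Subset (PartitionSeq.np P k)) →
    IsDesign P t k lam 𝔅 → DesignNonEmpty P k 𝔅 →
    t ≤ k → k ≤ v ∸ t →
    (x y : ℕ) → x ≤ y → y ≤ k →
    (i : Fin (PartitionSeq.np P x)) (b : Fin (PartitionSeq.np P k)) → b ∈ 𝔅 →
    CommutativeRing._≈_ Rg (Womega Rg S P k x y i b)
      (CommutativeRing._*_ Rg (ι Rg ((k ∸ x) C (y ∸ x))) (omega Rg S P k x i b))
lemma3p16 Rg S v P T t k _ _ _ _ _ k≤v∸t x y x≤y y≤k i b _ = begin
  Womega Rg S P k x y i b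
    ≈⟨ sumFin-conjugate Rg (np y) √X √B⁻¹ (λ j → sqrt (partSize P y j)) (λ j → sqrtInv (partSize P y j))
         (λ j → Rmat P x y i j) (λ j → rho P k y j b)
         (λ j → inv-sqrt (partSize P y j) (partSize-pos P y (≤-trans y≤k k≤v) j)) ⟩
  (√X ⊗ √B⁻¹) ⊗ ι Rg (∑[ j < np y ] (Rmat P x y i j * rho P k y j b))
    ≡⟨ cong (λ n → (√X ⊗ √B⁻¹) ⊗ ι Rg n) (∑-Rmat-rho P T x≤y y≤k k≤v i b) ⟩
  (√X ⊗ √B⁻¹) ⊗ ι Rg (binom * rho P k x i b)
    ≈⟨ ι-*-factor Rg √X √B⁻¹ binom (rho P k x i b) ⟩
  ι Rg binom ⊗ omega Rg S P k x i b ∎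
  where
  open PartitionSeq P using (np)
  open SqrtData S
  open CommutativeRing Rg using () renaming (_*_ to _⊗_)
  open import Relation.Binary.Reasoning.Setoid (CommutativeRing.setoid Rg)
  k≤v : k ≤ v
  k≤v = ≤-trans k≤v∸t (m∸n≤m v t)
  √X √B⁻¹ : CommutativeRing.Carrier Rg
  √X = sqrt (partSize P x i)
  √B⁻¹ = sqrtInv (partSize P k b)
  binom : ℕ
  binom = (k ∸ x) C (y ∸ x)
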